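{- The series $\mathcal{V}(z,q)$ and $\mathcal{X}(z,q)$ belong to $\mathscr{U}_{z,q}^2$. In particular, $V(m,n)\ge V(m+2,n)$ and $X(m,n)\ge X(m+2,n)$ for all integers $m,n\ge 0$.
   Context: $(a;q)_n=\prod_{0\le j<n}(1-aq^j)$ for $n\in\mathbb{N}_0\cup\{\infty\}$ and $(a,b;q)_n=(a;q)_n(b;q)_n$. Define $V(m,n),X(m,n)$ by the formal expansions (power series in $q$ whose coefficients are Laurent polynomials in $z$) $$\mathcal{V}(z,q)=\sum_{n\ge0}\sum_{m\in\mathbb{Z}}V(m,n)z^mq^n=\sum_{n\ge0}\frac{q^n}{(zq^{n+1},z^{ -1}q^{n+1};q)_\infty},\quad \mathcal{X}(z,q)=\sum_{n\ge0}\sum_{m\in\mathbb{Z}}X(m,n)z^mq^n=\sum_{n\ge0}\frac{q^{n+1}}{(zq,z^{ -1}q;q)_n}$$ (these count concave, resp. convex, compositions of $n$ by rank $m$). For $\nu\in\{1,2\}$, $\mathscr{U}_z^\nu$ is the set of Laurent polynomials $\sum_i c_iz^i$ with real $c_i\ge0$, $c_{ -i}=c_i$, and $c_{r+\ell\nu}\ge c_{r+(\ell+1)\nu}$ for all $0\le r<\nu$, $\ell\ge0$; a series $\sum_n C_n(z)q^n$ with Laurent polynomial coefficients lies in $\mathscr{U}_{z,q}^\nu$ if every $C_n(z)\in\mathscr{U}_z^\nu$. -}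

module Defs where

open import Data.Nat as ℕ using (ℕ; zero; suc; _+_; _*_; _∸_; _≤_; _<_; _≥_; _≤ᵇ_)
open import Data.Integer as ℤ using (ℤ; +_; -_; ∣_∣)
open import Data.Bool using (if_then_else_)
open import Data.Product using (_×_; ∃)
open import Relation.Binary.PropositionalEquality using (_≡_)

sumBelow : ℕ → (ℕ → ℕ) → ℕ
sumBelow zero    f = 0
sumBelow (suc n) f = sumBelow n f + f n

δ00 : ℕ → ℤ → ℕ
δ00 zero (+ zero) = 1
δ00 _    _        = 0

-- G j k n m = coefficient of z^m q^n in the formal expansion of
--   ∏_{i=0}^{k-1} 1 / ((1 - z q^(j+i)) (1 - z^{-1} q^(j+i))) ,
-- obtained by expanding each factor as the geometric series
--   Σ_{a,c ≥ 0} z^(a-c) q^((a+c)(j+i)).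
-- (Meaningful for j ≥ 1; then exponents a, c ≤ n suffice.)
G : ℕ → ℕ → ℕ → ℤ → ℕ
G j zero    n m = δ00 n m
G j (suc k) n m =
  sumBelow (suc n) λ a → sumBelow (suc n) λ c →
    if (a + c) * j ≤ᵇ n
      then G (suc j) k (n ∸ (a + c) * j) (m ℤ.- + a ℤ.+ + c)
      else 0

-- V(m,N): coefficient of z^m q^N in Σ_{k≥0} q^k / (z q^(k+1), z^{-1} q^(k+1); q)_∞.
-- Only k ≤ N contributes, and in the infinite product only factors with
-- exponent ≤ N matter (exponents k+1, …, N, i.e. N ∸ k factors).
V : ℤ → ℕ → ℕ
V m N = sumBelow (suc N) λ k → G (suc k) (N ∸ k) (N ∸ k) m

-- X(m,N): coefficient of z^m q^N in Σ_{k≥0} q^(k+1) / (z q, z^{-1} q; q)_k.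
-- Only k < N contributes.
X : ℤ → ℕ → ℕ
X m N = sumBelow N λ k → G 1 k (N ∸ suc k) m

-- 𝒰_z^ν : coefficient sequences c : ℤ → ℕ (nonnegativity automatic) of a
-- Laurent polynomial, symmetric, with c_{r+ℓν} ≥ c_{r+(ℓ+1)ν} for 0 ≤ r < ν, ℓ ≥ 0.
InUz : ℕ → (ℤ → ℕ) → Set
InUz ν c =
  (∃ λ (B : ℕ) → ∀ i → B < ∣ i ∣ → c i ≡ 0) ×
  (∀ i → c (- i) ≡ c i) ×
  (∀ (r ℓ : ℕ) → r < ν → c (+ (r + ℓ * ν)) ≥ c (+ (r + suc ℓ * ν)))

InUzq : ℕ → (ℤ → ℕ → ℕ) → Set
InUzq ν C = ∀ (n : ℕ) → InUz ν (λ m → C m n)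

{-# OPTIONS --safe #-}
-- The factor 1 / ((1 - z q^i)(1 - z⁻¹ q^i)) = Σ_{a,c} z^(a-c) q^((a+c) i) has as
-- q^(s i)-coefficient the window z^(-s) + z^(-s+2) + … + z^s. Multiplying a symmetric
-- coefficient sequence c with c_(m+2) ≤ c_m for m ≥ 0 by such a window keeps both
-- properties: the coefficient at m + 2 minus the one at m is c_(m+s+2) - c_(m-s), and
-- |m - s| ≤ m + s has the parity of m + s + 2. Induction over the factors puts every
-- q-coefficient of each summand of 𝒱 and 𝒳 in 𝒰²_z, which is closed under sums.
module Submission where

open import Defs
open import Data.Bool using (true; false; if_then_else_; T)
open import Data.Integer as ℤ using (ℤ; +_; -_; ∣_∣; -[1+_])
import Data.Integer.Properties as ℤ
import Data.Integer.Tactic.RingSolver as ℤ-Solver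
open import Data.Nat using (ℕ; zero; suc; _+_; _*_; _∸_; _≤_; _<_; _≤ᵇ_; z≤n)
open import Data.Nat.Properties
import Data.Nat.Tactic.RingSolver as ℕ-Solver
open import Data.Product using (_×_; _,_)
open import Data.Sum using (inj₁; inj₂)
open import Data.Unit using (tt)
open import Function using (_∘_)
open import Relation.Binary.PropositionalEquality

sumBelow-cong : ∀ n {f g : ℕ → ℕ} → (∀ k → f k ≡ g k) → sumBelow n f ≡ sumBelow n g
sumBelow-cong zero    f≡g = refl
sumBelow-cong (suc n) f≡g = cong₂ _+_ (sumBelow-cong n f≡g) (f≡g n)

sumBelow-mono : ∀ n {f g : ℕ → ℕ} → (∀ k → f k ≤ g k) → sumBelow n f ≤ sumBelow n g
sumBelow-mono zero    f≤g = z≤n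
sumBelow-mono (suc n) f≤g = +-mono-≤ (sumBelow-mono n f≤g) (f≤g n)

sumBelow-zero : ∀ n {f : ℕ → ℕ} → (∀ k → f k ≡ 0) → sumBelow n f ≡ 0
sumBelow-zero zero    f≡0 = refl
sumBelow-zero (suc n) f≡0 = cong₂ _+_ (sumBelow-zero n f≡0) (f≡0 n)

sumBelow-+ : ∀ n (f g : ℕ → ℕ) → sumBelow n (λ k → f k + g k) ≡ sumBelow n f + sumBelow n g
sumBelow-+ zero    f g = refl
sumBelow-+ (suc n) f g =
  trans (cong (_+ (f n + g n)) (sumBelow-+ n f g)) (interchange (sumBelow n f) (sumBelow n g) (f n) (g n))
  where
  interchange : ∀ a b x y → (a + b) + (x + y) ≡ (a + x) + (b + y)
  interchange = ℕ-Solver.solve-∀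

sumBelow-swap : ∀ n p (F : ℕ → ℕ → ℕ) →
                sumBelow n (λ a → sumBelow p (F a)) ≡ sumBelow p (λ c → sumBelow n (λ a → F a c))
sumBelow-swap zero    p F = sym (sumBelow-zero p (λ _ → refl))
sumBelow-swap (suc n) p F = trans (cong (_+ sumBelow p (F n)) (sumBelow-swap n p F)) (sym (sumBelow-+ p _ _))

sumBelow-suc : ∀ n (f : ℕ → ℕ) → sumBelow (suc n) f ≡ f 0 + sumBelow n (f ∘ suc)
sumBelow-suc zero    f = sym (+-identityʳ _)
sumBelow-suc (suc n) f = trans (cong (_+ f (suc n)) (sumBelow-suc n f)) (+-assoc (f 0) _ _)

sumBelow-shift : ∀ n (f : ℕ → ℕ) → f n ≡ 0 → sumBelow n f ≡ f 0 + sumBelow n (f ∘ suc)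
sumBelow-shift n f fn≡0 = begin
  sumBelow n f          ≡⟨ sym (+-identityʳ _) ⟩
  sumBelow n f + 0      ≡⟨ cong (λ w → sumBelow n f + w) (sym fn≡0) ⟩
  sumBelow (suc n) f    ≡⟨ sumBelow-suc n f ⟩
  f 0 + sumBelow n (f ∘ suc) ∎
  where open ≡-Reasoning

record Unimodal₂ (f : ℤ → ℕ) : Set where
  field
    symmetric : ∀ x → f (- x) ≡ f x
    antitone₂ : ∀ i → f (+ (2 + i)) ≤ f (+ i)

open Unimodal₂

Supported : ℕ → (ℤ → ℕ) → Set
Supported B f = ∀ x → B < ∣ x ∣ → f x ≡ 0

module _ {f : ℤ → ℕ} (f-unimodal : Unimodal₂ f) where

  f[t*2+i]≤f[i] : ∀ t i → f (+ (t * 2 + i)) ≤ f (+ i)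
  f[t*2+i]≤f[i] zero    i = ≤-refl
  f[t*2+i]≤f[i] (suc t) i = ≤-trans (antitone₂ f-unimodal (t * 2 + i)) (f[t*2+i]≤f[i] t i)

  f[2+p+s]≤f[p-s] : ∀ p s → f (+ (2 + p + s)) ≤ f (+ p ℤ.- + s)
  f[2+p+s]≤f[p-s] p s with ≤-total s p
  ... | inj₁ s≤p with d , refl ← m≤n⇒∃[o]m+o≡n s≤p =
    subst₂ _≤_ (cong (f ∘ +_) (two-steps s d)) (cong f (cancel (+ s) (+ d)))
      (f[t*2+i]≤f[i] (suc s) d)
    where
    two-steps : ∀ s d → suc s * 2 + d ≡ 2 + (s + d) + s
    two-steps = ℕ-Solver.solve-∀
    cancel : ∀ s d → d ≡ (s ℤ.+ d) ℤ.- s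
    cancel = ℤ-Solver.solve-∀
  ... | inj₂ p≤s with d , refl ← m≤n⇒∃[o]m+o≡n p≤s =
    subst₂ _≤_ (cong (f ∘ +_) (two-steps p d))
      (trans (sym (symmetric f-unimodal (+ d))) (cong f (cancel (+ p) (+ d))))
      (f[t*2+i]≤f[i] (suc p) d)
    where
    two-steps : ∀ p d → suc p * 2 + d ≡ 2 + p + (p + d)
    two-steps = ℕ-Solver.solve-∀
    cancel : ∀ p d → - d ≡ p ℤ.- (p ℤ.+ d)
    cancel = ℤ-Solver.solve-∀

unimodal-sumBelow : ∀ n {F : ℕ → ℤ → ℕ} → (∀ k → Unimodal₂ (F k)) →
                    Unimodal₂ (λ x → sumBelow n (λ k → F k x))
unimodal-sumBelow n F-unimodal = record
  { symmetric = λ x → sumBelow-cong n (λ k → symmetric (F-unimodal k) x)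
  ; antitone₂ = λ i → sumBelow-mono n (λ k → antitone₂ (F-unimodal k) i)
  }

unimodal-if : ∀ b {f : ℤ → ℕ} → Unimodal₂ f → Unimodal₂ (λ x → if b then f x else 0)
unimodal-if true  f-unimodal = f-unimodal
unimodal-if false f-unimodal = record { symmetric = λ _ → refl ; antitone₂ = λ _ → z≤n }

supported-sumBelow : ∀ n {B} {F : ℕ → ℤ → ℕ} → (∀ k → Supported B (F k)) →
                     Supported B (λ x → sumBelow n (λ k → F k x))
supported-sumBelow n F-supported x B<∣x∣ = sumBelow-zero n (λ k → F-supported k x B<∣x∣)

supported-mono : ∀ {B B′ f} → B ≤ B′ → Supported B f → Supported B′ f
supported-mono B≤B′ f-supported x B′<∣x∣ = f-supported x (≤-<-trans B≤B′ B′<∣x∣)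

inUz₂ : ∀ {B f} → Supported B f → Unimodal₂ f → InUz 2 f
inUz₂ {B} {f} f-supported f-unimodal =
  (B , f-supported) , symmetric f-unimodal ,
  λ r ℓ _ → subst (λ i → f (+ i) ≤ f (+ (r + ℓ * 2))) (sym (+-suc-suc r (ℓ * 2)))
              (antitone₂ f-unimodal (r + ℓ * 2))
  where
  +-suc-suc : ∀ r i → r + (2 + i) ≡ 2 + (r + i)
  +-suc-suc = ℕ-Solver.solve-∀

convolve : ℕ → (ℕ → ℤ → ℕ) → ℤ → ℕ
convolve n h m = sumBelow n λ a → sumBelow n λ c → h (a + c) (m ℤ.- + a ℤ.+ + c)

convolve-unimodal : ∀ n {h : ℕ → ℤ → ℕ} → (∀ s → Unimodal₂ (h s)) →
                    (∀ s x → n ≤ s → h s x ≡ 0) → Unimodal₂ (convolve n h)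
convolve-unimodal n {h} h-unimodal h-vanishes = record { symmetric = symm ; antitone₂ = anti }
  where
  term : ℤ → ℕ → ℕ → ℕ
  term m a c = h (a + c) (m ℤ.- + a ℤ.+ + c)

  symm : ∀ m → convolve n h (- m) ≡ convolve n h m
  symm m = trans (sumBelow-cong n λ a → sumBelow-cong n λ c → reflect a c)
                 (sumBelow-swap n n (λ c a → term m a c))
    where
    negate : ∀ m a c → - m ℤ.- a ℤ.+ c ≡ - (m ℤ.- c ℤ.+ a)
    negate = ℤ-Solver.solve-∀
    reflect : ∀ a c → term (- m) a c ≡ term m c a
    reflect a c = begin
      h (a + c) (- m ℤ.- + a ℤ.+ + c)   ≡⟨ cong (h (a + c)) (negate m (+ a) (+ c)) ⟩
      h (a + c) (- (m ℤ.- + c ℤ.+ + a)) ≡⟨ symmetric (h-unimodal (a + c)) _ ⟩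
      h (a + c) (m ℤ.- + c ℤ.+ + a)     ≡⟨ cong (λ s → h s (m ℤ.- + c ℤ.+ + a)) (+-comm a c) ⟩
      h (c + a) (m ℤ.- + c ℤ.+ + a)     ∎
      where open ≡-Reasoning

  -- Term (a + 1, c) at m + 2 equals term (a, c + 1) at m, so after peeling off the
  -- first row at m + 2 and the first column at m the remaining double sums agree.
  anti : ∀ p → convolve n h (+ (2 + p)) ≤ convolve n h (+ p)
  anti p = begin
    convolve n h (+ (2 + p))
      ≡⟨ sumBelow-shift n _ (sumBelow-zero n λ c → h-vanishes _ _ (m≤m+n n c)) ⟩
    sumBelow n (term (+ (2 + p)) 0) + sumBelow n (λ a → sumBelow n (term (+ (2 + p)) (suc a)))
      ≡⟨ cong (λ w → sumBelow n (term (+ (2 + p)) 0) + w)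
              (sumBelow-cong n λ a → sumBelow-cong n λ c → slide a c) ⟩
    sumBelow n (term (+ (2 + p)) 0) + sumBelow n (λ a → sumBelow n (term (+ p) a ∘ suc))
      ≤⟨ +-monoˡ-≤ _ (sumBelow-mono n edge) ⟩
    sumBelow n (λ a → term (+ p) a 0) + sumBelow n (λ a → sumBelow n (term (+ p) a ∘ suc))
      ≡⟨ sym (sumBelow-+ n _ _) ⟩
    sumBelow n (λ a → term (+ p) a 0 + sumBelow n (term (+ p) a ∘ suc))
      ≡⟨ sumBelow-cong n (λ a → sym (sumBelow-shift n _ (h-vanishes _ _ (m≤n+m n a)))) ⟩
    convolve n h (+ p) ∎
    where
    open ≤-Reasoning
    slide-ℤ : ∀ p a c → (+ 2 ℤ.+ p) ℤ.- (+ 1 ℤ.+ a) ℤ.+ c ≡ p ℤ.- a ℤ.+ (+ 1 ℤ.+ c)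
    slide-ℤ = ℤ-Solver.solve-∀
    slide : ∀ a c → term (+ (2 + p)) (suc a) c ≡ term (+ p) a (suc c)
    slide a c = cong₂ h (sym (+-suc a c)) (slide-ℤ (+ p) (+ a) (+ c))
    edge : ∀ s → term (+ (2 + p)) 0 s ≤ term (+ p) s 0
    edge s = subst₂ _≤_ (cong (λ t → h s (+ (t + s))) (sym (+-identityʳ (2 + p))))
                        (cong₂ h (sym (+-identityʳ s)) (sym (ℤ.+-identityʳ _)))
                        (f[2+p+s]≤f[p-s] (h-unimodal s) p s)

∣m∣≤a+c+∣m-a+c∣ : ∀ m a c → ∣ m ∣ ≤ (a + c) + ∣ m ℤ.- + a ℤ.+ + c ∣
∣m∣≤a+c+∣m-a+c∣ m a c = begin
  ∣ m ∣                          ≡⟨ cong ∣_∣ (split m (+ a) (+ c)) ⟩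
  ∣ (+ a ℤ.- + c) ℤ.+ x ∣        ≤⟨ ℤ.∣i+j∣≤∣i∣+∣j∣ (+ a ℤ.- + c) x ⟩
  ∣ + a ℤ.- + c ∣ + ∣ x ∣        ≤⟨ +-monoˡ-≤ ∣ x ∣ (ℤ.∣i-j∣≤∣i∣+∣j∣ (+ a) (+ c)) ⟩
  (a + c) + ∣ x ∣                ∎
  where
  open ≤-Reasoning
  x = m ℤ.- + a ℤ.+ + c
  split : ∀ m a c → m ≡ (a ℤ.- c) ℤ.+ (m ℤ.- a ℤ.+ c)
  split = ℤ-Solver.solve-∀

convolve-supported : ∀ n {B} {h : ℕ → ℤ → ℕ} → (∀ s x → B < s + ∣ x ∣ → h s x ≡ 0) →
                     Supported B (convolve n h)
convolve-supported n h-supported m B<∣m∣ =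
  sumBelow-zero n λ a → sumBelow-zero n λ c →
    h-supported (a + c) _ (<-≤-trans B<∣m∣ (∣m∣≤a+c+∣m-a+c∣ m a c))

δ00-unimodal : ∀ n → Unimodal₂ (δ00 n)
δ00-unimodal n = record { symmetric = symm n ; antitone₂ = anti n }
  where
  symm : ∀ n x → δ00 n (- x) ≡ δ00 n x
  symm zero    (+ zero)  = refl
  symm zero    (+ suc _) = refl
  symm zero    -[1+ _ ]  = refl
  symm (suc n) _         = refl
  anti : ∀ n i → δ00 n (+ (2 + i)) ≤ δ00 n (+ i)
  anti zero    _ = z≤n
  anti (suc n) _ = z≤n

δ00-supported : ∀ n → Supported n (δ00 n)
δ00-supported zero    (+ suc _) _ = refl
δ00-supported zero    -[1+ _ ]  _ = refl
δ00-supported (suc n) _         _ = refl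

-- The factor with exponent j contributes z^(a-c) q^((a+c) j), so
-- G j (suc k) n is definitionally convolve (suc n) (layer j k n).
layer : ℕ → ℕ → ℕ → ℕ → ℤ → ℕ
layer j k n s x = if s * j ≤ᵇ n then G (suc j) k (n ∸ s * j) x else 0

G-supported : ∀ j k n → Supported n (G (suc j) k n)
layer-supported : ∀ j k n s x → n < s + ∣ x ∣ → layer (suc j) k n s x ≡ 0

G-supported j zero    n = δ00-supported n
G-supported j (suc k) n = convolve-supported (suc n) (layer-supported j k n)

layer-supported j k n s x n<s+∣x∣ with s * suc j ≤ᵇ n in eq
... | false = refl
... | true  = G-supported (suc j) k (n ∸ s * suc j) x (begin-strict
  n ∸ s * suc j  ≤⟨ ∸-monoʳ-≤ n (m≤m*n s (suc j)) ⟩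
  n ∸ s          <⟨ ∸-monoˡ-< n<s+∣x∣ s≤n ⟩
  s + ∣ x ∣ ∸ s  ≡⟨ m+n∸m≡n s ∣ x ∣ ⟩
  ∣ x ∣          ∎)
  where
  open ≤-Reasoning
  s≤n : s ≤ n
  s≤n = ≤-trans (m≤m*n s (suc j)) (≤ᵇ⇒≤ _ _ (subst T (sym eq) tt))

G-unimodal : ∀ j k n → Unimodal₂ (G (suc j) k n)
G-unimodal j zero    n = δ00-unimodal n
G-unimodal j (suc k) n = convolve-unimodal (suc n)
  (λ s → unimodal-if (s * suc j ≤ᵇ n) (G-unimodal (suc j) k (n ∸ s * suc j)))
  (λ s x n<s → layer-supported j k n s x (≤-trans n<s (m≤m+n s ∣ x ∣)))

V-unimodal : ∀ N → Unimodal₂ (λ m → V m N)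
V-unimodal N = unimodal-sumBelow (suc N) (λ k → G-unimodal k (N ∸ k) (N ∸ k))

V-supported : ∀ N → Supported N (λ m → V m N)
V-supported N = supported-sumBelow (suc N) λ k →
  supported-mono (m∸n≤m N k) (G-supported k (N ∸ k) (N ∸ k))

X-unimodal : ∀ N → Unimodal₂ (λ m → X m N)
X-unimodal N = unimodal-sumBelow N (λ k → G-unimodal 0 k (N ∸ suc k))

X-supported : ∀ N → Supported N (λ m → X m N)
X-supported N = supported-sumBelow N λ k →
  supported-mono (m∸n≤m N (suc k)) (G-supported 0 k (N ∸ suc k))

theorem4p2 : InUzq 2 V × InUzq 2 X
theorem4p2 = (λ N → inUz₂ (V-supported N) (V-unimodal N))
           , (λ N → inUz₂ (X-supported N) (X-unimodal N))
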